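{- For every formula $F$ containing none of the choice operators $\sqcap,\sqcup,\sqcap x,\sqcup x$ (i.e. every formula of the classical first-order language without equality and function symbols), $\mathbf{CL2}\vdash F$ if and only if $F$ is valid in classical first-order logic. That is, the $\sqcap,\sqcup,\sqcap x,\sqcup x$-free fragment of $\mathbf{CL2}$ is exactly classical logic.
   Context: Formulas are built from nonlogical atoms $p(t_1,\ldots,t_n)$ ($p$ an $n$-ary predicate letter, $t_i$ terms, terms being variables and constants $0,1,2,\ldots$) and logical atoms $\top,\bot$ by $\neg$, $\wedge,\vee$ ($n$-ary), $\rightarrow$, $\sqcap,\sqcup$ ($n$-ary) and quantifiers $\forall x,\exists x,\sqcap x,\sqcup x$. Classical validity of formulas with constants is understood as usual (equivalently, treating constants as free variables). Logic $\mathbf{CL2}$. Reading $F\rightarrow G$ as $\neg F\vee G$, an occurrence is positive (negative) if in the scope of an even (odd) number of $\neg$; surface if not in the scope of any of $\sqcap,\sqcup,\sqcap x,\sqcup x$. The elementarization of $F$ replaces every surface occurrence of $G_1\sqcup\cdots\sqcup G_n$ or $\sqcup xG$ by $\bot$ and of $G_1\sqcap\cdots\sqcap G_n$ or $\sqcap xG$ by $\top$; $F$ is stable iff its elementarization is classically valid. Rules: Rule A: $\vec H\mapsto F$, $F$ stable, $\vec H$ a set of formulas such that (i) for each positive (resp. negative) surface occurrence of $G_1\sqcap\cdots\sqcap G_n$ (resp. $G_1\sqcup\cdots\sqcup G_n$) and each $i$, $\vec H$ contains the result of replacing that occurrence by $G_i$; (ii) for each positive (resp. negative) surface occurrence of $\sqcap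 xG(x)$ (resp. $\sqcup xG(x)$), $\vec H$ contains the result of replacing it by $G(y)$ for some variable $y$ not occurring in $F$. Rule B1: $F'\mapsto F$, $F'$ obtained by replacing a negative (resp. positive) surface occurrence of $G_1\sqcap\cdots\sqcap G_n$ (resp. $G_1\sqcup\cdots\sqcup G_n$) by some $G_i$. Rule B2: $F'\mapsto F$, $F'$ obtained by replacing a negative (resp. positive) surface occurrence of $\sqcap xG(x)$ (resp. $\sqcup xG(x)$) by $G(t)$ for a term $t$ such that, if $t$ is a variable, neither that occurrence nor any free occurrence of $x$ in $G(x)$ is in the scope of $\forall t,\exists t,\sqcap t,\sqcup t$. $\mathbf{CL2}\vdash F$ means $F$ is derivable by these rules. -}

module Defs where

open import Data.Nat using (ℕ; _≡ᵇ_)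
open import Data.Bool using (Bool; true; false; not; _∧_; _∨_; if_then_else_)
open import Data.List using (List; []; _∷_; _++_)
open import Data.List.Membership.Propositional using (_∈_)
open import Data.Vec using (Vec)
import Data.Vec as V
open import Data.Product using (Σ; _×_)
open import Data.Empty using (⊥)
open import Data.Unit using (⊤)
open import Relation.Nullary using (¬_)
open import Relation.Binary.PropositionalEquality using (_≡_)

data Term : Set where
  var : ℕ → Term
  con : ℕ → Term

-- Formulas.  A predicate letter is a pair (name p, arity n).
data Formula : Set where
  atom  : (p n : ℕ) → Vec Term n → Formula
  tt ff : Formula
  neg   : Formula → Formula
  conj  : List Formula → Formula
  disj  : List Formula → Formula
  imp   : Formula → Formula → Formula
  chconj : List Formula → Formula
  chdisj : List Formula → Formula
  all   : ℕ → Formula → Formula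
  ex    : ℕ → Formula → Formula
  chall : ℕ → Formula → Formula
  chex  : ℕ → Formula → Formula

mutual
  choiceFree : Formula → Bool
  choiceFree (atom p n ts) = true
  choiceFree tt = true
  choiceFree ff = true
  choiceFree (neg F) = choiceFree F
  choiceFree (conj Fs) = choiceFreeL Fs
  choiceFree (disj Fs) = choiceFreeL Fs
  choiceFree (imp F G) = choiceFree F ∧ choiceFree G
  choiceFree (chconj Fs) = false
  choiceFree (chdisj Fs) = false
  choiceFree (all x F) = choiceFree F
  choiceFree (ex x F) = choiceFree F
  choiceFree (chall x F) = false
  choiceFree (chex x F) = false

  choiceFreeL : List Formula → Bool
  choiceFreeL [] = true
  choiceFreeL (F ∷ Fs) = choiceFree F ∧ choiceFreeL Fs

-- Classical semantics (Tarskian, rendered via the Gödel–Gentzen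
-- reading so that it is classical in the constructive metatheory).

record Interp (D : Set) : Set₁ where
  field
    rel : (p n : ℕ) → Vec D n → Set
    cst : ℕ → D

update : {D : Set} → (ℕ → D) → ℕ → D → ℕ → D
update ρ x d y = if y ≡ᵇ x then d else ρ y

evalT : {D : Set} → Interp D → (ℕ → D) → Term → D
evalT I ρ (var x) = ρ x
evalT I ρ (con c) = Interp.cst I c

mutual
  -- Choice operators are given the value ⊥; this is irrelevant, since
  -- Sat is only used on choice-free formulas.
  Sat : {D : Set} → Interp D → (ℕ → D) → Formula → Set
  Sat I ρ (atom p n ts) = ¬ ¬ Interp.rel I p n (V.map (evalT I ρ) ts)
  Sat I ρ tt = ⊤
  Sat I ρ ff = ⊥
  Sat I ρ (neg F) = ¬ Sat I ρ F
  Sat I ρ (conj Fs) = SatAll I ρ Fs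
  Sat I ρ (disj Fs) = ¬ SatNone I ρ Fs
  Sat I ρ (imp F G) = Sat I ρ F → Sat I ρ G
  Sat I ρ (chconj Fs) = ⊥
  Sat I ρ (chdisj Fs) = ⊥
  Sat {D} I ρ (all x F) = (d : D) → Sat I (update ρ x d) F
  Sat {D} I ρ (ex x F) = ¬ ((d : D) → ¬ Sat I (update ρ x d) F)
  Sat I ρ (chall x F) = ⊥
  Sat I ρ (chex x F) = ⊥

  SatAll : {D : Set} → Interp D → (ℕ → D) → List Formula → Set
  SatAll I ρ [] = ⊤
  SatAll I ρ (F ∷ Fs) = Sat I ρ F × SatAll I ρ Fs

  SatNone : {D : Set} → Interp D → (ℕ → D) → List Formula → Set
  SatNone I ρ [] = ⊤
  SatNone I ρ (F ∷ Fs) = ¬ Sat I ρ F × SatNone I ρ Fs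

Valid : Formula → Set₁
Valid F = (D : Set) → D → (I : Interp D) → (ρ : ℕ → D) → Sat I ρ F

-- Surface occurrences: one-hole contexts not passing through any
-- choice operator.

data Ctx : Set where
  hole  : Ctx
  negC  : Ctx → Ctx
  conjC : List Formula → Ctx → List Formula → Ctx
  disjC : List Formula → Ctx → List Formula → Ctx
  impL  : Ctx → Formula → Ctx
  impR  : Formula → Ctx → Ctx
  allC  : ℕ → Ctx → Ctx
  exC   : ℕ → Ctx → Ctx

plug : Ctx → Formula → Formula
plug hole G = G
plug (negC C) G = neg (plug C G)
plug (conjC as C bs) G = conj (as ++ plug C G ∷ bs)
plug (disjC as C bs) G = disj (as ++ plug C G ∷ bs)
plug (impL C B) G = imp (plug C G) B
plug (impR A C) G = imp A (plug C G)
plug (allC x C) G = all x (plug C G)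
plug (exC x C) G = ex x (plug C G)

-- true = positive occurrence (F → G read as ¬F ∨ G)
positive : Ctx → Bool
positive hole = true
positive (negC C) = not (positive C)
positive (conjC _ C _) = positive C
positive (disjC _ C _) = positive C
positive (impL C _) = not (positive C)
positive (impR _ C) = positive C
positive (allC _ C) = positive C
positive (exC _ C) = positive C

ctxBinds : ℕ → Ctx → Bool
ctxBinds v hole = false
ctxBinds v (negC C) = ctxBinds v C
ctxBinds v (conjC _ C _) = ctxBinds v C
ctxBinds v (disjC _ C _) = ctxBinds v C
ctxBinds v (impL C _) = ctxBinds v C
ctxBinds v (impR _ C) = ctxBinds v C
ctxBinds v (allC y C) = (y ≡ᵇ v) ∨ ctxBinds v C
ctxBinds v (exC y C) = (y ≡ᵇ v) ∨ ctxBinds v C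

mutual
  elem : Formula → Formula
  elem (atom p n ts) = atom p n ts
  elem tt = tt
  elem ff = ff
  elem (neg F) = neg (elem F)
  elem (conj Fs) = conj (elemL Fs)
  elem (disj Fs) = disj (elemL Fs)
  elem (imp F G) = imp (elem F) (elem G)
  elem (chconj Fs) = tt
  elem (chdisj Fs) = ff
  elem (all x F) = all x (elem F)
  elem (ex x F) = ex x (elem F)
  elem (chall x F) = tt
  elem (chex x F) = ff

  elemL : List Formula → List Formula
  elemL [] = []
  elemL (F ∷ Fs) = elem F ∷ elemL Fs

Stable : Formula → Set₁
Stable F = Valid (elem F)

occT : ℕ → Term → Bool
occT y (var x) = x ≡ᵇ y
occT y (con c) = false

occTs : ∀ {n} → ℕ → Vec Term n → Bool
occTs y V.[] = false
occTs y (t V.∷ ts) = occT y t ∨ occTs y ts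

mutual
  occurs : ℕ → Formula → Bool
  occurs y (atom p n ts) = occTs y ts
  occurs y tt = false
  occurs y ff = false
  occurs y (neg F) = occurs y F
  occurs y (conj Fs) = occursL y Fs
  occurs y (disj Fs) = occursL y Fs
  occurs y (imp F G) = occurs y F ∨ occurs y G
  occurs y (chconj Fs) = occursL y Fs
  occurs y (chdisj Fs) = occursL y Fs
  occurs y (all x F) = (x ≡ᵇ y) ∨ occurs y F
  occurs y (ex x F) = (x ≡ᵇ y) ∨ occurs y F
  occurs y (chall x F) = (x ≡ᵇ y) ∨ occurs y F
  occurs y (chex x F) = (x ≡ᵇ y) ∨ occurs y F

  occursL : ℕ → List Formula → Bool
  occursL y [] = false
  occursL y (F ∷ Fs) = occurs y F ∨ occursL y Fs

mutual
  free : ℕ → Formula → Bool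
  free y (atom p n ts) = occTs y ts
  free y tt = false
  free y ff = false
  free y (neg F) = free y F
  free y (conj Fs) = freeL y Fs
  free y (disj Fs) = freeL y Fs
  free y (imp F G) = free y F ∨ free y G
  free y (chconj Fs) = freeL y Fs
  free y (chdisj Fs) = freeL y Fs
  free y (all x F) = if x ≡ᵇ y then false else free y F
  free y (ex x F) = if x ≡ᵇ y then false else free y F
  free y (chall x F) = if x ≡ᵇ y then false else free y F
  free y (chex x F) = if x ≡ᵇ y then false else free y F

  freeL : ℕ → List Formula → Bool
  freeL y [] = false
  freeL y (F ∷ Fs) = free y F ∨ freeL y Fs

-- some free occurrence of x in F lies in the scope of a quantifier
-- (∀v, ∃v, ⊓v or ⊔v) on v
mutual
  captured : ℕ → ℕ → Formula → Bool
  captured v x (atom p n ts) = false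
  captured v x tt = false
  captured v x ff = false
  captured v x (neg F) = captured v x F
  captured v x (conj Fs) = capturedL v x Fs
  captured v x (disj Fs) = capturedL v x Fs
  captured v x (imp F G) = captured v x F ∨ captured v x G
  captured v x (chconj Fs) = capturedL v x Fs
  captured v x (chdisj Fs) = capturedL v x Fs
  captured v x (all y F) = capQ v x y F
  captured v x (ex y F) = capQ v x y F
  captured v x (chall y F) = capQ v x y F
  captured v x (chex y F) = capQ v x y F

  capQ : ℕ → ℕ → ℕ → Formula → Bool
  capQ v x y F =
    if y ≡ᵇ x then false
    else (if y ≡ᵇ v then free x F else captured v x F)

  capturedL : ℕ → ℕ → List Formula → Bool
  capturedL v x [] = false
  capturedL v x (F ∷ Fs) = captured v x F ∨ capturedL v x Fs

substT : ℕ → Term → Term → Term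
substT x t (var y) = if y ≡ᵇ x then t else var y
substT x t (con c) = con c

mutual
  subst : ℕ → Term → Formula → Formula
  subst x t (atom p n ts) = atom p n (V.map (substT x t) ts)
  subst x t tt = tt
  subst x t ff = ff
  subst x t (neg F) = neg (subst x t F)
  subst x t (conj Fs) = conj (substL x t Fs)
  subst x t (disj Fs) = disj (substL x t Fs)
  subst x t (imp F G) = imp (subst x t F) (subst x t G)
  subst x t (chconj Fs) = chconj (substL x t Fs)
  subst x t (chdisj Fs) = chdisj (substL x t Fs)
  subst x t (all y F) = all y (if y ≡ᵇ x then F else subst x t F)
  subst x t (ex y F) = ex y (if y ≡ᵇ x then F else subst x t F)
  subst x t (chall y F) = chall y (if y ≡ᵇ x then F else subst x t F)
  subst x t (chex y F) = chex y (if y ≡ᵇ x then F else subst x t F)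

  substL : ℕ → Term → List Formula → List Formula
  substL x t [] = []
  substL x t (F ∷ Fs) = subst x t F ∷ substL x t Fs

B2ok : Ctx → ℕ → Formula → Term → Bool
B2ok C x G (var v) = not (ctxBinds v C) ∧ not (captured v x G)
B2ok C x G (con c) = true

data CL2 : Formula → Set₁ where
  ruleA : ∀ {F} → Stable F
    → (∀ C Gs → positive C ≡ true → F ≡ plug C (chconj Gs)
         → ∀ {G} → G ∈ Gs → CL2 (plug C G))
    → (∀ C Gs → positive C ≡ false → F ≡ plug C (chdisj Gs)
         → ∀ {G} → G ∈ Gs → CL2 (plug C G))
    → (∀ C x G → positive C ≡ true → F ≡ plug C (chall x G)
         → Σ ℕ λ y → occurs y F ≡ false × CL2 (plug C (subst x (var y) G)))
    → (∀ C x G → positive C ≡ false → F ≡ plug C (chex x G)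
         → Σ ℕ λ y → occurs y F ≡ false × CL2 (plug C (subst x (var y) G)))
    → CL2 F
  ruleB1⊓ : ∀ C Gs {G} → positive C ≡ false → G ∈ Gs
    → CL2 (plug C G) → CL2 (plug C (chconj Gs))
  ruleB1⊔ : ∀ C Gs {G} → positive C ≡ true → G ∈ Gs
    → CL2 (plug C G) → CL2 (plug C (chdisj Gs))
  ruleB2⊓ : ∀ C x G t → positive C ≡ false → B2ok C x G t ≡ true
    → CL2 (plug C (subst x t G)) → CL2 (plug C (chall x G))
  ruleB2⊔ : ∀ C x G t → positive C ≡ true → B2ok C x G t ≡ true
    → CL2 (plug C (subst x t G)) → CL2 (plug C (chex x G))

{-# OPTIONS --safe #-}
module Submission where

-- A choice-free formula has no surface occurrence of a choice operator, so
-- Rule B1/B2 never applies to it and Rule A applies with no premises at all;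
-- and since elementarization fixes it, the stability condition of Rule A is
-- exactly classical validity.

open import Defs
open import Data.Bool using (true; false)
open import Data.Bool.Properties using (∧-conicalˡ; ∧-conicalʳ; not-¬)
open import Data.Empty using (⊥-elim)
open import Data.List using ([]; _∷_; _++_)
open import Data.Product using (_×_; _,_)
open import Relation.Binary.PropositionalEquality using (_≡_; _≢_; refl; sym; cong; cong₂)
  renaming (subst to ≡-subst)

mutual
  elem-choiceFree : ∀ F → choiceFree F ≡ true → elem F ≡ F
  elem-choiceFree (atom p n ts) cf = refl
  elem-choiceFree tt cf = refl
  elem-choiceFree ff cf = refl
  elem-choiceFree (neg F) cf = cong neg (elem-choiceFree F cf)
  elem-choiceFree (conj Fs) cf = cong conj (elemL-choiceFreeL Fs cf)
  elem-choiceFree (disj Fs) cf = cong disj (elemL-choiceFreeL Fs cf)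
  elem-choiceFree (imp F G) cf =
    cong₂ imp (elem-choiceFree F (∧-conicalˡ _ _ cf)) (elem-choiceFree G (∧-conicalʳ _ _ cf))
  elem-choiceFree (all x F) cf = cong (all x) (elem-choiceFree F cf)
  elem-choiceFree (ex x F) cf = cong (ex x) (elem-choiceFree F cf)

  elemL-choiceFreeL : ∀ Fs → choiceFreeL Fs ≡ true → elemL Fs ≡ Fs
  elemL-choiceFreeL [] cf = refl
  elemL-choiceFreeL (F ∷ Fs) cf =
    cong₂ _∷_ (elem-choiceFree F (∧-conicalˡ _ _ cf)) (elemL-choiceFreeL Fs (∧-conicalʳ _ _ cf))

choiceFreeL-++-∷ : ∀ Fs G Gs → choiceFreeL (Fs ++ G ∷ Gs) ≡ true → choiceFree G ≡ true
choiceFreeL-++-∷ [] G Gs cf = ∧-conicalˡ _ _ cf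
choiceFreeL-++-∷ (F ∷ Fs) G Gs cf = choiceFreeL-++-∷ Fs G Gs (∧-conicalʳ _ _ cf)

choiceFree-plug : ∀ C G → choiceFree (plug C G) ≡ true → choiceFree G ≡ true
choiceFree-plug hole G cf = cf
choiceFree-plug (negC C) G cf = choiceFree-plug C G cf
choiceFree-plug (conjC Fs C Gs) G cf = choiceFree-plug C G (choiceFreeL-++-∷ Fs _ Gs cf)
choiceFree-plug (disjC Fs C Gs) G cf = choiceFree-plug C G (choiceFreeL-++-∷ Fs _ Gs cf)
choiceFree-plug (impL C B) G cf = choiceFree-plug C G (∧-conicalˡ _ _ cf)
choiceFree-plug (impR A C) G cf = choiceFree-plug C G (∧-conicalʳ _ _ cf)
choiceFree-plug (allC x C) G cf = choiceFree-plug C G cf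
choiceFree-plug (exC x C) G cf = choiceFree-plug C G cf

choiceFree⇒no-surface-choice : ∀ {F} C G → choiceFree F ≡ true → F ≡ plug C G →
                               choiceFree G ≢ false
choiceFree⇒no-surface-choice C G cf refl = not-¬ (choiceFree-plug C G cf)

CL2⇒Valid : ∀ F → choiceFree F ≡ true → CL2 F → Valid F
CL2⇒Valid F cf (ruleA stable _ _ _ _) = ≡-subst Valid (elem-choiceFree F cf) stable
CL2⇒Valid _ cf (ruleB1⊓ C _ _ _ _) = ⊥-elim (choiceFree⇒no-surface-choice C _ cf refl refl)
CL2⇒Valid _ cf (ruleB1⊔ C _ _ _ _) = ⊥-elim (choiceFree⇒no-surface-choice C _ cf refl refl)
CL2⇒Valid _ cf (ruleB2⊓ C _ _ _ _ _ _) = ⊥-elim (choiceFree⇒no-surface-choice C _ cf refl refl)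
CL2⇒Valid _ cf (ruleB2⊔ C _ _ _ _ _ _) = ⊥-elim (choiceFree⇒no-surface-choice C _ cf refl refl)

Valid⇒CL2 : ∀ F → choiceFree F ≡ true → Valid F → CL2 F
Valid⇒CL2 F cf valid = ruleA (≡-subst Valid (sym (elem-choiceFree F cf)) valid)
  (λ C _ _ F≡ _ → ⊥-elim (choiceFree⇒no-surface-choice C _ cf F≡ refl))
  (λ C _ _ F≡ _ → ⊥-elim (choiceFree⇒no-surface-choice C _ cf F≡ refl))
  (λ C _ _ _ F≡ → ⊥-elim (choiceFree⇒no-surface-choice C _ cf F≡ refl))
  (λ C _ _ _ F≡ → ⊥-elim (choiceFree⇒no-surface-choice C _ cf F≡ refl))

proposition5p6 : (F : Formula) → choiceFree F ≡ true
    → (CL2 F → Valid F) × (Valid F → CL2 F)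
proposition5p6 F cf = CL2⇒Valid F cf , Valid⇒CL2 F cf
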